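{- A player starts with capital $0$ and at each round independently gains $1$ with probability $1/2$ or $2$ with probability $1/2$. Let $X_n$ be the number of rounds until the capital is $\ge n$ for the first time. Then, as $n\to\infty$, $E[X_n]=\tfrac23 n+\tfrac29+o(1)$, $\operatorname{Var}[X_n]=\tfrac{2}{27}n+\tfrac{2}{81}+o(1)$, $E[(X_n-E X_n)^3]=\tfrac{2}{81}n-\tfrac{26}{729}+o(1)$, and $E[(X_n-EX_n)^4]=\tfrac{4}{243}n^2+\tfrac{2}{243}n-\tfrac{62}{2187}+o(1)$. -}

module Defs where

open import Data.Bool using (Bool; true; false)
open import Data.Nat as ℕ using (ℕ; zero; suc; _≤?_)
open import Data.Vec using (Vec; []; _∷_)
open import Data.List using (List; []; _∷_; map; _++_; foldr)
open import Data.Integer using (+_)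
open import Data.Rational using (ℚ; 0ℚ; 1ℚ; ½; _+_; _-_; _*_; _<_; ∣_∣; _/_)
open import Data.Product using (Σ; ∃; _×_)
open import Relation.Nullary using (yes; no)

gain : Bool → ℕ
gain false = 1
gain true  = 2

hitFrom : ∀ {m} → ℕ → ℕ → Vec Bool m → ℕ
hitFrom n c v with n ≤? c
... | yes _ = 0
hitFrom n c []       | no _ = 0
hitFrom n c (b ∷ bs) | no _ = suc (hitFrom n (c ℕ.+ gain b) bs)

-- X_n on the sample space of the first n rounds (each round gains ≥ 1,
-- so the capital is ≥ n after at most n rounds): start with capital 0.
X : (n : ℕ) → Vec Bool n → ℕ
X n v = hitFrom n 0 v

allOutcomes : (m : ℕ) → List (Vec Bool m)
allOutcomes zero    = [] ∷ []
allOutcomes (suc m) = map (false ∷_) (allOutcomes m) ++ map (true ∷_) (allOutcomes m)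

sumℚ : List ℚ → ℚ
sumℚ = foldr _+_ 0ℚ

half^ : ℕ → ℚ
half^ zero    = 1ℚ
half^ (suc m) = ½ * half^ m

_^ℚ_ : ℚ → ℕ → ℚ
q ^ℚ zero  = 1ℚ
q ^ℚ suc k = q * (q ^ℚ k)

toℚ : ℕ → ℚ
toℚ k = (+ k) / 1

E : (n : ℕ) → (ℚ → ℚ) → ℚ
E n f = half^ n * sumℚ (map (λ v → f (toℚ (X n v))) (allOutcomes n))

mean : ℕ → ℚ
mean n = E n (λ x → x)

centralMoment : ℕ → ℕ → ℚ
centralMoment k n = E n (λ x → (x - mean n) ^ℚ k)

IsLittleO1 : (ℕ → ℚ) → Set
IsLittleO1 a = ∀ (ε : ℚ) → 0ℚ < ε → ∃ λ N → ∀ n → N ℕ.≤ n → ∣ a n ∣ < ε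

module Submission where

-- Conditioning on the first round turns E[f(X_n)] into a recursion in the
-- distance still to be covered: if Y_d is the number of rounds needed to gain
-- at least d, then  E f(Y_{d+2}) = ½ (E f(1 + Y_{d+1}) + E f(1 + Y_d)).
-- This expectation is linear in f, so with the binomial theorem the raw moments
-- M_j(d) = E[Y_d^j] satisfy  M_j(d+2) = ½ Σ_{i≤j} C(j,i) (M_i(d+1) + M_i(d)),
-- and induction on d identifies M_j(d), j ≤ 4, with explicit polynomials in
-- d and r = (-1/2)^d.  The binomial theorem once more expresses the central
-- moments through the raw ones, so each quantity of the theorem minus its
-- claimed asymptotics is a polynomial in (d, r) all of whose terms carry a
-- factor r: it is O(d^3 2^-d) = O(1/d), hence o(1).
--
-- The explicit formulas are written once, over an arbitrary raw ring:
-- evaluated in ℚ they are the closed forms, read as solver syntax they let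
-- the ring solver verify the polynomial identities.

open import Defs
open import Level using (0ℓ)
open import Algebra.Bundles using (CommutativeRing; CommutativeSemiring)
open import Algebra.Bundles.Raw using (RawRing)
open import Data.Bool using (Bool; true; false)
open import Data.Fin using (Fin; toℕ; zero; suc)
open import Data.Fin.Patterns using (0F; 1F; 2F; 3F; 4F)
open import Data.Fin.Properties using (toℕ≤pred[n])
open import Data.Integer as ℤ using (+_)
open import Data.List using (List; []; _∷_; map; _++_; length)
open import Data.List.Properties using (map-++; map-∘; map-cong)
open import Data.List.Relation.Unary.All using (All; []; _∷_; all?)
open import Data.Nat as ℕ using (ℕ; zero; suc; s≤s; z≤n)
import Data.Nat.Properties as ℕP
import Data.Nat.DivMod as ℕD
open import Data.Nat.Combinatorics using (_C_)
open import Data.Nat.Coprimality using (1-coprimeTo) renaming (sym to coprime-sym)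
open import Data.Product using (_×_; _,_; ∃)
open import Data.Rational using (ℚ; mkℚ; 0ℚ; 1ℚ; ½; -½; _/_)
import Data.Rational.Unnormalised as ℚᵘ
import Data.Rational.Unnormalised.Properties as ℚᵘP
open import Data.Rational.Solver using (module +-*-Solver)
open import Data.Integer.Tactic.RingSolver using () renaming (solve-∀ to ℤ-ring)
open import Data.Nat.Tactic.RingSolver using () renaming (solve-∀ to ℕ-ring)
open import Data.Vec using (Vec; []; _∷_)
open import Data.Vec.Functional using (Vector)
open import Function using (_∘_)
open import Relation.Binary.PropositionalEquality
open import Relation.Nullary using (Dec; yes; no)
open import Relation.Nullary.Decidable using (toWitness; _×-dec_)
open import Relation.Nullary.Negation using (contradiction)

open +-*-Solver using (Polynomial; con; _:+_; _:*_; :-_; solve; _:=_)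

module Formulas (R : RawRing 0ℓ 0ℓ) (κ : ℚ → RawRing.Carrier R) where
  open RawRing R renaming (Carrier to A)
  open import Algebra.Definitions.RawSemiring rawSemiring public
    using (sum; _^_) renaming (_×_ to _times_)

  infixl 6 _-_
  _-_ : A → A → A
  a - b = a + - b

  -- E[Y_d^j] for j ≤ 4, as a polynomial in x = d and r = (-1/2)^d.
  rawMoment : ℕ → A → A → A
  rawMoment 0 x r = 1#
  rawMoment 1 x r = κ (+ 2 / 3) * x + κ (+ 2 / 9) - κ (+ 2 / 9) * r
  rawMoment 2 x r = κ (+ 4 / 9) * x ^ 2 + κ (+ 10 / 27) * x + κ (+ 2 / 27)
                  - κ (+ 4 / 27) * x * r - κ (+ 2 / 27) * r
  rawMoment 3 x r = κ (+ 8 / 27) * x ^ 3 + κ (+ 4 / 9) * x ^ 2 + κ (+ 2 / 9) * x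
                  - κ (+ 2 / 243) - κ (+ 2 / 27) * x ^ 2 * r - κ (+ 2 / 81) * x * r
                  + κ (+ 2 / 243) * r
  rawMoment 4 x r = κ (+ 16 / 81) * x ^ 4 + κ (+ 112 / 243) * x ^ 3
                  + κ (+ 100 / 243) * x ^ 2 + κ (+ 22 / 729) * x - κ (+ 110 / 2187)
                  - κ (+ 8 / 243) * x ^ 3 * r + κ (+ 4 / 243) * x ^ 2 * r
                  + κ (+ 16 / 243) * x * r + κ (+ 110 / 2187) * r
  rawMoment (suc (suc (suc (suc (suc _))))) x r = 0#

  binomialCoeff : (j : ℕ) → A → Fin (suc j) → A
  binomialCoeff j c i = (j C toℕ i) times (c ^ (j ℕ.∸ toℕ i))

  -- The right-hand side of the moment recursion, fed with the closed forms
  -- at distances d + 1 and d (x = d, so x + 1 and r · (-1/2) describe d + 1).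
  recursionStep : ℕ → A → A → A
  recursionStep j x r =
    κ ½ * (sum (λ i → binomialCoeff j 1# i * rawMoment (toℕ i) (x + 1#) (κ -½ * r))
         + sum (λ i → binomialCoeff j 1# i * rawMoment (toℕ i) x r))

  twoRoundsLater : ℕ → A → A → A
  twoRoundsLater j x r = rawMoment j (x + 1# + 1#) (κ -½ * (κ -½ * r))

  central : ℕ → A → A → A
  central j x r =
    sum (λ i → binomialCoeff j (- rawMoment 1 x r) i * rawMoment (toℕ i) x r)

  statistic : ℕ → A → A → A
  statistic 1 x r = rawMoment 1 x r
  statistic j x r = central j x r

  approximation : Fin 5 → A → A
  approximation 0F x = 1#
  approximation 1F x = κ (+ 2 / 3) * x + κ (+ 2 / 9)
  approximation 2F x = κ (+ 2 / 27) * x + κ (+ 2 / 81)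
  approximation 3F x = κ (+ 2 / 81) * x - κ (+ 26 / 729)
  approximation 4F x = κ (+ 4 / 243) * (x * x) + κ (+ 2 / 243) * x - κ (+ 62 / 2187)

  decaying : List (ℚ × ℕ × ℕ) → A → A → A
  decaying []                  x r = 0#
  decaying ((c , i , k) ∷ ts) x r = κ c * (x ^ i * r ^ suc k) + decaying ts x r

open import Data.Rational
  using (_+_; _-_; _*_; -_; _≤_; _<_; ∣_∣; _≤?_; toℚᵘ; nonNegative; positive)
open import Data.Rational.Properties
  using (+-*-commutativeRing; +-*-rawRing; +-identityˡ; +-identityʳ; +-assoc;
         *-identityˡ; *-identityʳ; *-zeroˡ; *-comm; *-distribʳ-+;
         normalize-coprime; normalize-nonNeg; toℚᵘ-injective; toℚᵘ-homo-+;
         toℚᵘ-homo-*; nonNegative⁻¹; positive⁻¹; ≤-refl; ≤-trans; ≤-reflexive;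
         +-mono-≤; +-monoʳ-≤; +-monoʳ-<; *-monoʳ-≤-nonNeg; *-monoˡ-≤-nonNeg;
         *-monoʳ-<-pos; *-cancelʳ-<-nonNeg; ∣p+q∣≤∣p∣+∣q∣; ∣p*q∣≡∣p∣*∣q∣; 0≤∣p∣;
         0≤p⇒∣p∣≡p; ≤ᵇ⇒≤; nonNeg*nonNeg⇒nonNeg; module ≤-Reasoning)

ℚ-commutativeSemiring : CommutativeSemiring 0ℓ 0ℓ
ℚ-commutativeSemiring = CommutativeRing.commutativeSemiring +-*-commutativeRing

import Algebra.Properties.CommutativeSemiring.Binomial ℚ-commutativeSemiring as Binomial
open import Algebra.Properties.Semiring.Mult
  (CommutativeRing.semiring +-*-commutativeRing) using (×-assoc-*)
open import Algebra.Properties.Monoid.Sum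
  (CommutativeRing.+-monoid +-*-commutativeRing) using (sum-cong-≗)

module V = Formulas +-*-rawRing (λ q → q)
open V using (sum; _^_)

polynomialRing : RawRing 0ℓ 0ℓ
polynomialRing = record
  { Carrier = Polynomial 2 ; _≈_ = _≡_ ; _+_ = _:+_ ; _*_ = _:*_ ; -_ = :-_
  ; 0# = con 0ℚ ; 1# = con 1ℚ }

module P = Formulas polynomialRing con

upTo4 : (Q : ℕ → Set) → Q 0 → Q 1 → Q 2 → Q 3 → Q 4 → ∀ j → j ℕ.≤ 4 → Q j
upTo4 Q q₀ q₁ q₂ q₃ q₄ 0 _ = q₀
upTo4 Q q₀ q₁ q₂ q₃ q₄ 1 _ = q₁
upTo4 Q q₀ q₁ q₂ q₃ q₄ 2 _ = q₂
upTo4 Q q₀ q₁ q₂ q₃ q₄ 3 _ = q₃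
upTo4 Q q₀ q₁ q₂ q₃ q₄ 4 _ = q₄
upTo4 Q q₀ q₁ q₂ q₃ q₄ (suc (suc (suc (suc (suc _))))) (s≤s (s≤s (s≤s (s≤s ()))))

½-double : ∀ c → ½ * (c + c) ≡ c
½-double = solve 1 (λ c → con ½ :* (c :+ c) := c) refl

toℚ≡mkℚ : ∀ k → toℚ k ≡ mkℚ (+ k) 0 (coprime-sym (1-coprimeTo k))
toℚ≡mkℚ k = normalize-coprime (coprime-sym (1-coprimeTo k))

toℚ-suc : ∀ k → toℚ (suc k) ≡ toℚ k + 1ℚ
toℚ-suc k = toℚᵘ-injective (begin
  toℚᵘ (toℚ (suc k))               ≡⟨ cong toℚᵘ (toℚ≡mkℚ (suc k)) ⟩
  ℚᵘ.mkℚᵘ (+ suc k) 0               ≈⟨ ℚᵘ.*≡* (cross-multiplied (+ k)) ⟩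
  ℚᵘ.mkℚᵘ (+ k) 0 ℚᵘ.+ toℚᵘ 1ℚ      ≡⟨ cong (λ z → toℚᵘ z ℚᵘ.+ toℚᵘ 1ℚ) (toℚ≡mkℚ k) ⟨
  toℚᵘ (toℚ k) ℚᵘ.+ toℚᵘ 1ℚ        ≈⟨ toℚᵘ-homo-+ (toℚ k) 1ℚ ⟨
  toℚᵘ (toℚ k + 1ℚ) ∎)
  where
  open ℚᵘP.≃-Reasoning
  cross-multiplied : ∀ z → (+ 1 ℤ.+ z) ℤ.* + 1 ≡ (z ℤ.* + 1 ℤ.+ + 1 ℤ.* + 1) ℤ.* + 1
  cross-multiplied = ℤ-ring

toℚ-+ : ∀ a b → toℚ (a ℕ.+ b) ≡ toℚ a + toℚ b
toℚ-+ zero    b = sym (+-identityˡ (toℚ b))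
toℚ-+ (suc a) b = begin
  toℚ (suc (a ℕ.+ b))      ≡⟨ toℚ-suc (a ℕ.+ b) ⟩
  toℚ (a ℕ.+ b) + 1ℚ       ≡⟨ cong (_+ 1ℚ) (toℚ-+ a b) ⟩
  toℚ a + toℚ b + 1ℚ       ≡⟨ solve 2 (λ A B → A :+ B :+ con 1ℚ := A :+ con 1ℚ :+ B) refl (toℚ a) (toℚ b) ⟩
  toℚ a + 1ℚ + toℚ b       ≡⟨ cong (_+ toℚ b) (toℚ-suc a) ⟨
  toℚ (suc a) + toℚ b ∎
  where open ≡-Reasoning

toℚ-* : ∀ a b → toℚ (a ℕ.* b) ≡ toℚ a * toℚ b
toℚ-* zero    b = sym (*-zeroˡ (toℚ b))
toℚ-* (suc a) b = begin
  toℚ (b ℕ.+ a ℕ.* b)      ≡⟨ toℚ-+ b (a ℕ.* b) ⟩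
  toℚ b + toℚ (a ℕ.* b)    ≡⟨ cong (_+_ (toℚ b)) (toℚ-* a b) ⟩
  toℚ b + toℚ a * toℚ b    ≡⟨ solve 2 (λ A B → B :+ A :* B := (A :+ con 1ℚ) :* B) refl (toℚ a) (toℚ b) ⟩
  (toℚ a + 1ℚ) * toℚ b     ≡⟨ cong (_* toℚ b) (toℚ-suc a) ⟨
  toℚ (suc a) * toℚ b ∎
  where open ≡-Reasoning

toℚ-^ : ∀ a i → toℚ (a ℕ.^ i) ≡ toℚ a ^ i
toℚ-^ a zero    = refl
toℚ-^ a (suc i) = trans (toℚ-* a (a ℕ.^ i)) (cong (toℚ a *_) (toℚ-^ a i))

toℚ-nonNeg : ∀ a → 0ℚ ≤ toℚ a
toℚ-nonNeg a = nonNegative⁻¹ (toℚ a) {{normalize-nonNeg a 1}}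

toℚ-mono-≤ : ∀ {a b} → a ℕ.≤ b → toℚ a ≤ toℚ b
toℚ-mono-≤ {a} {b} a≤b = begin
  toℚ a                     ≡⟨ +-identityʳ (toℚ a) ⟨
  toℚ a + 0ℚ                ≤⟨ +-monoʳ-≤ (toℚ a) (toℚ-nonNeg (b ℕ.∸ a)) ⟩
  toℚ a + toℚ (b ℕ.∸ a)     ≡⟨ toℚ-+ a (b ℕ.∸ a) ⟨
  toℚ (a ℕ.+ (b ℕ.∸ a))     ≡⟨ cong toℚ (ℕP.m+[n∸m]≡n a≤b) ⟩
  toℚ b ∎
  where open ≤-Reasoning

toℚ-mono-< : ∀ {a b} → a ℕ.< b → toℚ a < toℚ b
toℚ-mono-< {a} {b} a<b = begin-strict
  toℚ a                     ≡⟨ +-identityʳ (toℚ a) ⟨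
  toℚ a + 0ℚ                <⟨ +-monoʳ-< (toℚ a) (positive⁻¹ 1ℚ) ⟩
  toℚ a + 1ℚ                ≡⟨ toℚ-suc a ⟨
  toℚ (suc a)               ≤⟨ toℚ-mono-≤ a<b ⟩
  toℚ b ∎
  where open ≤-Reasoning

average : (m : ℕ) → (Vec Bool m → ℚ) → ℚ
average m g = half^ m * sumℚ (map g (allOutcomes m))

sumℚ-++ : ∀ xs ys → sumℚ (xs ++ ys) ≡ sumℚ xs + sumℚ ys
sumℚ-++ []       ys = sym (+-identityˡ (sumℚ ys))
sumℚ-++ (x ∷ xs) ys =
  trans (cong (_+_ x) (sumℚ-++ xs ys)) (sym (+-assoc x (sumℚ xs) (sumℚ ys)))

average-cong : ∀ m {g h} → (∀ v → g v ≡ h v) → average m g ≡ average m h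
average-cong m g≗h = cong (λ s → half^ m * sumℚ s) (map-cong g≗h (allOutcomes m))

average-step : ∀ m g →
  average (suc m) g ≡ ½ * (average m (g ∘ (false ∷_)) + average m (g ∘ (true ∷_)))
average-step m g = begin
  half^ (suc m) * sumℚ (map g (map (false ∷_) vs ++ map (true ∷_) vs))
    ≡⟨ cong (λ s → half^ (suc m) * sumℚ s) (map-++ g (map (false ∷_) vs) _) ⟩
  half^ (suc m) * sumℚ (map g (map (false ∷_) vs) ++ map g (map (true ∷_) vs))
    ≡⟨ cong (half^ (suc m) *_) (sumℚ-++ (map g (map (false ∷_) vs)) _) ⟩
  half^ (suc m) * (sumℚ (map g (map (false ∷_) vs)) + sumℚ (map g (map (true ∷_) vs)))
    ≡⟨ cong₂ (λ a b → half^ (suc m) * (sumℚ a + sumℚ b)) (sym (map-∘ vs)) (sym (map-∘ vs)) ⟩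
  half^ (suc m) * (S₀ + S₁)
    ≡⟨ solve 3 (λ h a b → (con ½ :* h) :* (a :+ b) := con ½ :* (h :* a :+ h :* b))
             refl (half^ m) S₀ S₁ ⟩
  ½ * (average m (g ∘ (false ∷_)) + average m (g ∘ (true ∷_))) ∎
  where
  open ≡-Reasoning
  vs : List (Vec Bool m)
  vs = allOutcomes m
  S₀ S₁ : ℚ
  S₀ = sumℚ (map (g ∘ (false ∷_)) vs)
  S₁ = sumℚ (map (g ∘ (true ∷_)) vs)

average-const : ∀ m {g} c → (∀ v → g v ≡ c) → average m g ≡ c
average-const zero    c g≡c =
  trans (cong (λ z → 1ℚ * (z + 0ℚ)) (g≡c [])) (trans (*-identityˡ _) (+-identityʳ c))
average-const (suc m) c g≡c = begin
  average (suc m) _                            ≡⟨ average-step m _ ⟩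
  ½ * (average m _ + average m _)              ≡⟨ cong₂ (λ a b → ½ * (a + b))
                                                    (average-const m c (g≡c ∘ (false ∷_)))
                                                    (average-const m c (g≡c ∘ (true ∷_))) ⟩
  ½ * (c + c)                                  ≡⟨ ½-double c ⟩
  c ∎
  where open ≡-Reasoning

-- The number of rounds of v needed to gain at least d (0 if v runs out).
hitDist : ∀ {m} → ℕ → Vec Bool m → ℕ
hitDist zero    _        = 0
hitDist (suc d) []       = 0
hitDist (suc d) (b ∷ bs) = suc (hitDist (suc d ℕ.∸ gain b) bs)

hitFrom≡hitDist : ∀ {m} n c (v : Vec Bool m) → hitFrom n c v ≡ hitDist (n ℕ.∸ c) v
hitFrom≡hitDist n c v with n ℕ.≤? c | n ℕ.∸ c in gap
... | yes n≤c | d = sym (cong (λ e → hitDist e v)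
                          (trans (sym gap) (ℕP.m≤n⇒m∸n≡0 n≤c)))
... | no n≰c | zero  = contradiction (ℕP.m∸n≡0⇒m≤n gap) n≰c
hitFrom≡hitDist n c []       | no n≰c | suc d = refl
hitFrom≡hitDist n c (b ∷ bs) | no n≰c | suc d =
  cong suc (trans (hitFrom≡hitDist n (c ℕ.+ gain b) bs)
                  (cong (λ e → hitDist e bs)
                        (trans (sym (ℕP.∸-+-assoc n c (gain b))) (cong (ℕ._∸ gain b) gap))))

-- expectAt d f = E[f(Y_d)], computed by conditioning on the first round.
expectAt : ℕ → (ℕ → ℚ) → ℚ
expectAt zero          f = f 0
expectAt (suc zero)    f = f 1
expectAt (suc (suc d)) f = ½ * (expectAt (suc d) (f ∘ suc) + expectAt d (f ∘ suc))

expectAt-step : ∀ d f →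
  expectAt (suc d) f ≡ ½ * (expectAt d (f ∘ suc) + expectAt (d ℕ.∸ 1) (f ∘ suc))
expectAt-step zero    f = sym (½-double (f 1))
expectAt-step (suc d) f = refl

average-hitDist : ∀ m d f → d ℕ.≤ m → average m (λ v → f (hitDist d v)) ≡ expectAt d f
average-hitDist m       zero    f _         = average-const m (f 0) (λ _ → refl)
average-hitDist (suc m) (suc d) f (s≤s d≤m) = begin
  average (suc m) (λ v → f (hitDist (suc d) v))
    ≡⟨ average-step m _ ⟩
  ½ * (average m (λ v → f (suc (hitDist d v)))
       + average m (λ v → f (suc (hitDist (d ℕ.∸ 1) v))))
    ≡⟨ cong₂ (λ a b → ½ * (a + b))
             (average-hitDist m d (f ∘ suc) d≤m)
             (average-hitDist m (d ℕ.∸ 1) (f ∘ suc) (ℕP.≤-trans (ℕP.m∸n≤m d 1) d≤m)) ⟩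
  ½ * (expectAt d (f ∘ suc) + expectAt (d ℕ.∸ 1) (f ∘ suc))
    ≡⟨ sym (expectAt-step d f) ⟩
  expectAt (suc d) f ∎
  where open ≡-Reasoning

E≡expectAt : ∀ n g → E n g ≡ expectAt n (g ∘ toℚ)
E≡expectAt n g =
  trans (average-cong n (λ v → cong (g ∘ toℚ) (hitFrom≡hitDist n 0 v)))
        (average-hitDist n n (g ∘ toℚ) ℕP.≤-refl)

expectAt-cong : ∀ d {f g} → (∀ k → f k ≡ g k) → expectAt d f ≡ expectAt d g
expectAt-cong zero          f≗g = f≗g 0
expectAt-cong (suc zero)    f≗g = f≗g 1
expectAt-cong (suc (suc d)) f≗g = cong₂ (λ a b → ½ * (a + b))
  (expectAt-cong (suc d) (f≗g ∘ suc)) (expectAt-cong d (f≗g ∘ suc))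

expectAt-const : ∀ d a → expectAt d (λ _ → a) ≡ a
expectAt-const zero          a = refl
expectAt-const (suc zero)    a = refl
expectAt-const (suc (suc d)) a =
  trans (cong₂ (λ u v → ½ * (u + v)) (expectAt-const (suc d) a) (expectAt-const d a))
        (½-double a)

expectAt-+ : ∀ d f g → expectAt d (λ k → f k + g k) ≡ expectAt d f + expectAt d g
expectAt-+ zero          f g = refl
expectAt-+ (suc zero)    f g = refl
expectAt-+ (suc (suc d)) f g =
  trans (cong₂ (λ u v → ½ * (u + v)) (expectAt-+ (suc d) (f ∘ suc) (g ∘ suc))
                                     (expectAt-+ d (f ∘ suc) (g ∘ suc)))
        (solve 4 (λ a b c e → con ½ :* ((a :+ b) :+ (c :+ e))
                              := con ½ :* (a :+ c) :+ con ½ :* (b :+ e)) refl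
               (expectAt (suc d) (f ∘ suc)) (expectAt (suc d) (g ∘ suc))
               (expectAt d (f ∘ suc)) (expectAt d (g ∘ suc)))

expectAt-scale : ∀ d a f → expectAt d (λ k → a * f k) ≡ a * expectAt d f
expectAt-scale zero          a f = refl
expectAt-scale (suc zero)    a f = refl
expectAt-scale (suc (suc d)) a f =
  trans (cong₂ (λ u v → ½ * (u + v)) (expectAt-scale (suc d) a (f ∘ suc))
                                     (expectAt-scale d a (f ∘ suc)))
        (solve 3 (λ a b c → con ½ :* (a :* b :+ a :* c) := a :* (con ½ :* (b :+ c)))
               refl a (expectAt (suc d) (f ∘ suc)) (expectAt d (f ∘ suc)))

expectAt-sum : ∀ d {n} (a : Vector ℚ n) (f : Fin n → ℕ → ℚ) →
  expectAt d (λ k → sum (λ i → a i * f i k)) ≡ sum (λ i → a i * expectAt d (f i))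
expectAt-sum d {zero}  a f = expectAt-const d 0ℚ
expectAt-sum d {suc n} a f =
  trans (expectAt-+ d (λ k → a zero * f zero k) (λ k → sum (λ i → a (suc i) * f (suc i) k)))
        (cong₂ _+_ (expectAt-scale d (a zero) (f zero))
                   (expectAt-sum d (a ∘ suc) (f ∘ suc)))

moment : ℕ → ℕ → ℚ
moment j d = expectAt d (λ k → toℚ k ^ j)

-- (-1/2)^d: the oscillating, geometrically decaying part of the moments.
decay : ℕ → ℚ
decay d = -½ ^ d

binomial : ∀ j y c → (y + c) ^ j ≡ sum (λ i → V.binomialCoeff j c i * y ^ toℕ i)
binomial j y c = trans (Binomial.theorem j y c) (sum-cong-≗ collect)
  where
  collect : ∀ i → (j C toℕ i) V.times (y ^ toℕ i * c ^ (j ℕ.∸ toℕ i))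
                ≡ V.binomialCoeff j c i * y ^ toℕ i
  collect i = trans (cong ((j C toℕ i) V.times_) (*-comm (y ^ toℕ i) _))
                    (sym (×-assoc-* (j C toℕ i) (c ^ (j ℕ.∸ toℕ i)) (y ^ toℕ i)))

expect-binomial : ∀ d j c →
  expectAt d (λ k → (toℚ k + c) ^ j) ≡ sum (λ i → V.binomialCoeff j c i * moment (toℕ i) d)
expect-binomial d j c =
  trans (expectAt-cong d (λ k → binomial j (toℚ k) c))
        (expectAt-sum d (V.binomialCoeff j c) (λ i k → toℚ k ^ toℕ i))

moment-recursion : ∀ j d →
  moment j (suc (suc d))
    ≡ ½ * (sum (λ i → V.binomialCoeff j 1ℚ i * moment (toℕ i) (suc d))
         + sum (λ i → V.binomialCoeff j 1ℚ i * moment (toℕ i) d))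
moment-recursion j d = cong₂ (λ a b → ½ * (a + b)) (shifted (suc d)) (shifted d)
  where
  shifted : ∀ e → expectAt e (λ k → toℚ (suc k) ^ j)
                  ≡ sum (λ i → V.binomialCoeff j 1ℚ i * moment (toℕ i) e)
  shifted e = trans (expectAt-cong e (λ k → cong (_^ j) (toℚ-suc k)))
                    (expect-binomial e j 1ℚ)

closedForm-step : ∀ j → j ℕ.≤ 4 →
  ∀ x r → V.recursionStep j x r ≡ V.twoRoundsLater j x r
closedForm-step = upTo4 (λ j → ∀ x r → V.recursionStep j x r ≡ V.twoRoundsLater j x r)
  (solve 2 (λ x r → P.recursionStep 0 x r := P.twoRoundsLater 0 x r) refl)
  (solve 2 (λ x r → P.recursionStep 1 x r := P.twoRoundsLater 1 x r) refl)
  (solve 2 (λ x r → P.recursionStep 2 x r := P.twoRoundsLater 2 x r) refl)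
  (solve 2 (λ x r → P.recursionStep 3 x r := P.twoRoundsLater 3 x r) refl)
  (solve 2 (λ x r → P.recursionStep 4 x r := P.twoRoundsLater 4 x r) refl)

ClosedAt : ℕ → Set
ClosedAt d = ∀ j → j ℕ.≤ 4 → moment j d ≡ V.rawMoment j (toℚ d) (decay d)

closed-base₀ : ClosedAt 0
closed-base₀ = upTo4 (λ j → moment j 0 ≡ V.rawMoment j (toℚ 0) (decay 0))
  refl refl refl refl refl

closed-base₁ : ClosedAt 1
closed-base₁ = upTo4 (λ j → moment j 1 ≡ V.rawMoment j (toℚ 1) (decay 1))
  refl refl refl refl refl

closed-step : ∀ d → ClosedAt (suc d) → ClosedAt d → ClosedAt (suc (suc d))
closed-step d closed₊ closed j j≤4 = begin
  moment j (suc (suc d))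
    ≡⟨ moment-recursion j d ⟩
  ½ * (sum (λ i → b i * moment (toℕ i) (suc d)) + sum (λ i → b i * moment (toℕ i) d))
    ≡⟨ cong₂ (λ u v → ½ * (u + v)) (sum-cong-≗ (λ i → cong (b i *_) (next i)))
                                   (sum-cong-≗ (λ i → cong (b i *_) (this i))) ⟩
  V.recursionStep j (toℚ d) (decay d)
    ≡⟨ closedForm-step j j≤4 (toℚ d) (decay d) ⟩
  V.rawMoment j (toℚ d + 1ℚ + 1ℚ) (decay (suc (suc d)))
    ≡⟨ cong (λ x → V.rawMoment j x (decay (suc (suc d))))
            (sym (trans (toℚ-suc (suc d)) (cong (_+ 1ℚ) (toℚ-suc d)))) ⟩
  V.rawMoment j (toℚ (suc (suc d))) (decay (suc (suc d))) ∎
  where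
  open ≡-Reasoning
  b : Fin (suc j) → ℚ
  b = V.binomialCoeff j 1ℚ
  i≤4 : (i : Fin (suc j)) → toℕ i ℕ.≤ 4
  i≤4 i = ℕP.≤-trans (toℕ≤pred[n] i) j≤4
  this : (i : Fin (suc j)) → moment (toℕ i) d ≡ V.rawMoment (toℕ i) (toℚ d) (decay d)
  this i = closed (toℕ i) (i≤4 i)
  next : (i : Fin (suc j)) →
    moment (toℕ i) (suc d) ≡ V.rawMoment (toℕ i) (toℚ d + 1ℚ) (decay (suc d))
  next i = trans (closed₊ (toℕ i) (i≤4 i))
                 (cong (λ x → V.rawMoment (toℕ i) x (decay (suc d))) (toℚ-suc d))

moment-closed : ∀ d → ClosedAt d
moment-closed zero          = closed-base₀
moment-closed (suc zero)    = closed-base₁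
moment-closed (suc (suc d)) = closed-step d (moment-closed (suc d)) (moment-closed d)

statistic : ℕ → ℕ → ℚ
statistic 1 n = mean n
statistic j n = centralMoment j n

mean-closed : ∀ n → mean n ≡ V.rawMoment 1 (toℚ n) (decay n)
mean-closed n = begin
  mean n                       ≡⟨ E≡expectAt n (λ y → y) ⟩
  expectAt n toℚ               ≡⟨ expectAt-cong n (λ k → sym (*-identityʳ (toℚ k))) ⟩
  moment 1 n                   ≡⟨ moment-closed n 1 (s≤s z≤n) ⟩
  V.rawMoment 1 (toℚ n) (decay n) ∎
  where open ≡-Reasoning

^ℚ≡^ : ∀ q k → q ^ℚ k ≡ q ^ k
^ℚ≡^ q zero    = refl
^ℚ≡^ q (suc k) = cong (q *_) (^ℚ≡^ q k)

central-closed : ∀ j n → j ℕ.≤ 4 → centralMoment j n ≡ V.central j (toℚ n) (decay n)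
central-closed j n j≤4 = begin
  centralMoment j n
    ≡⟨ E≡expectAt n (λ y → (y - mean n) ^ℚ j) ⟩
  expectAt n (λ k → (toℚ k - mean n) ^ℚ j)
    ≡⟨ expectAt-cong n (λ k → ^ℚ≡^ (toℚ k - mean n) j) ⟩
  expectAt n (λ k → (toℚ k + - mean n) ^ j)
    ≡⟨ expect-binomial n j (- mean n) ⟩
  sum (λ i → V.binomialCoeff j (- mean n) i * moment (toℕ i) n)
    ≡⟨ sum-cong-≗ (λ i → cong₂ (λ μ m → V.binomialCoeff j (- μ) i * m)
                               (mean-closed n)
                               (moment-closed n (toℕ i) (ℕP.≤-trans (toℕ≤pred[n] i) j≤4))) ⟩
  V.central j (toℚ n) (decay n) ∎
  where open ≡-Reasoning

statistic-closed : ∀ j n → j ℕ.≤ 4 → statistic j n ≡ V.statistic j (toℚ n) (decay n)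
statistic-closed 0             n = central-closed 0 n
statistic-closed 1             n = λ _ → mean-closed n
statistic-closed (suc (suc j)) n = central-closed (suc (suc j)) n

errorTerms : Fin 5 → List (ℚ × ℕ × ℕ)
errorTerms 0F = []
errorTerms 1F = (- (+ 2 / 9) , 0 , 0) ∷ []
errorTerms 2F = (+ 2 / 81 , 0 , 0) ∷ (- (+ 4 / 81) , 0 , 1) ∷ (+ 4 / 27 , 1 , 0) ∷ []
errorTerms 3F =
  (+ 10 / 243 , 0 , 0) ∷ (+ 4 / 243 , 0 , 1) ∷ (- (+ 16 / 729) , 0 , 2)
  ∷ (+ 2 / 27 , 1 , 0) ∷ (+ 8 / 81 , 1 , 1) ∷ (- (+ 2 / 27) , 2 , 0) ∷ []
errorTerms 4F =
  (- (+ 2 / 2187) , 0 , 0) ∷ (+ 64 / 2187 , 0 , 1) ∷ (+ 16 / 2187 , 0 , 2)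
  ∷ (- (+ 16 / 2187) , 0 , 3) ∷ (+ 32 / 729 , 1 , 1) ∷ (+ 32 / 729 , 1 , 2)
  ∷ (- (+ 4 / 81) , 2 , 0) ∷ (- (+ 16 / 243) , 2 , 1) ∷ (+ 8 / 243 , 3 , 0) ∷ []

error-identity : (j : Fin 5) → ∀ x r →
  V.statistic (toℕ j) x r - V.approximation j x ≡ V.decaying (errorTerms j) x r
error-identity 0F = solve 2 (λ x r → P.statistic 0 x r P.- P.approximation 0F x
                                     := P.decaying (errorTerms 0F) x r) refl
error-identity 1F = solve 2 (λ x r → P.statistic 1 x r P.- P.approximation 1F x
                                     := P.decaying (errorTerms 1F) x r) refl
error-identity 2F = solve 2 (λ x r → P.statistic 2 x r P.- P.approximation 2F x
                                     := P.decaying (errorTerms 2F) x r) refl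
error-identity 3F = solve 2 (λ x r → P.statistic 3 x r P.- P.approximation 3F x
                                     := P.decaying (errorTerms 3F) x r) refl
error-identity 4F = solve 2 (λ x r → P.statistic 4 x r P.- P.approximation 4F x
                                     := P.decaying (errorTerms 4F) x r) refl

InverseBound : (ℕ → ℚ) → ℕ → Set
InverseBound a K = ∀ n → ∣ a n ∣ * toℚ (suc n) ≤ toℚ K

archimedean : ∀ ε → 0ℚ < ε → ∃ λ D → 1ℚ ≤ ε * toℚ D
archimedean ε@(mkℚ (+ suc p) d _) _ =
  suc d , ≤-trans (toℚ-mono-≤ {1} {suc p} (s≤s z≤n)) (≤-reflexive (sym ε*denominator))
  where
  ε*denominator : ε * toℚ (suc d) ≡ toℚ (suc p)
  ε*denominator = toℚᵘ-injective (begin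
    toℚᵘ (ε * toℚ (suc d))                   ≈⟨ toℚᵘ-homo-* ε (toℚ (suc d)) ⟩
    toℚᵘ ε ℚᵘ.* toℚᵘ (toℚ (suc d))           ≡⟨ cong (λ z → toℚᵘ ε ℚᵘ.* toℚᵘ z) (toℚ≡mkℚ (suc d)) ⟩
    toℚᵘ ε ℚᵘ.* ℚᵘ.mkℚᵘ (+ suc d) 0         ≈⟨ ℚᵘ.*≡* (cong (λ z → + suc z) (sym (cancel d p))) ⟩
    ℚᵘ.mkℚᵘ (+ suc p) 0                      ≡⟨ cong toℚᵘ (toℚ≡mkℚ (suc p)) ⟨
    toℚᵘ (toℚ (suc p)) ∎)
    where
    open ℚᵘP.≃-Reasoning
    cancel : ∀ d p → d ℕ.* 1 ℕ.+ p ℕ.* suc (d ℕ.* 1) ≡ (d ℕ.+ p ℕ.* suc d) ℕ.* 1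
    cancel = ℕ-ring

archimedean ε@(mkℚ (+ zero)   _ _) 0<ε with positive {ε} 0<ε
... | ()
archimedean ε@(mkℚ ℤ.-[1+ _ ] _ _) 0<ε with positive {ε} 0<ε
... | ()

-- O(1/n) implies o(1): for n ≥ K D with 1/D ≤ ε one has ∣ a n ∣ ≤ K/(n+1) < ε.
inverseBound⇒littleO : ∀ a K → InverseBound a K → IsLittleO1 a
inverseBound⇒littleO a K bound ε 0<ε with archimedean ε 0<ε
... | D , 1≤εD = K ℕ.* D , λ n KD≤n →
  *-cancelʳ-<-nonNeg (toℚ (suc n)) {{nonNegative (toℚ-nonNeg (suc n))}} (begin-strict
    ∣ a n ∣ * toℚ (suc n)     ≤⟨ bound n ⟩
    toℚ K                     ≡⟨ *-identityʳ (toℚ K) ⟨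
    toℚ K * 1ℚ                ≤⟨ *-monoˡ-≤-nonNeg (toℚ K) {{nonNegative (toℚ-nonNeg K)}} 1≤εD ⟩
    toℚ K * (ε * toℚ D)       ≡⟨ solve 3 (λ k e d → k :* (e :* d) := e :* (k :* d)) refl (toℚ K) ε (toℚ D) ⟩
    ε * (toℚ K * toℚ D)       ≡⟨ cong (ε *_) (toℚ-* K D) ⟨
    ε * toℚ (K ℕ.* D)         <⟨ *-monoʳ-<-pos ε {{positive 0<ε}} (toℚ-mono-< (s≤s KD≤n)) ⟩
    ε * toℚ (suc n) ∎)
  where open ≤-Reasoning

inverseBound-+ : ∀ a b K L → InverseBound a K → InverseBound b L →
  InverseBound (λ n → a n + b n) (K ℕ.+ L)
inverseBound-+ a b K L boundᵃ boundᵇ n = begin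
  ∣ a n + b n ∣ * t               ≤⟨ *-monoʳ-≤-nonNeg t {{nonNegative (toℚ-nonNeg (suc n))}}
                                                      (∣p+q∣≤∣p∣+∣q∣ (a n) (b n)) ⟩
  (∣ a n ∣ + ∣ b n ∣) * t         ≡⟨ *-distribʳ-+ t ∣ a n ∣ ∣ b n ∣ ⟩
  ∣ a n ∣ * t + ∣ b n ∣ * t       ≤⟨ +-mono-≤ (boundᵃ n) (boundᵇ n) ⟩
  toℚ K + toℚ L                   ≡⟨ toℚ-+ K L ⟨
  toℚ (K ℕ.+ L) ∎
  where
  open ≤-Reasoning
  t : ℚ
  t = toℚ (suc n)

littleO-cong : ∀ {a b} → (∀ n → a n ≡ b n) → IsLittleO1 b → IsLittleO1 a
littleO-cong a≗b o ε 0<ε with o ε 0<ε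
... | N , small = N , λ n N≤n → subst (λ z → ∣ z ∣ < ε) (sym (a≗b n)) (small n N≤n)

suc≤2^ : ∀ q → suc q ℕ.≤ 2 ℕ.^ q
suc≤2^ zero    = s≤s z≤n
suc≤2^ (suc q) = ℕP.+-mono-≤ (ℕP.≤-trans (s≤s z≤n) (suc≤2^ q))
                             (ℕP.≤-trans (suc≤2^ q) (ℕP.m≤m+n (2 ℕ.^ q) 0))

-- (n + 1)^4 ≤ 256 · 2^n, via n + 1 ≤ 4 (q + 1) and q + 1 ≤ 2^q for q = ⌊n/4⌋.
pow4≤2^ : ∀ n → suc n ℕ.^ 4 ℕ.≤ 256 ℕ.* 2 ℕ.^ n
pow4≤2^ n = begin
  suc n ℕ.^ 4               ≤⟨ ℕP.^-monoˡ-≤ 4 n<4[q+1] ⟩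
  (suc q ℕ.* 4) ℕ.^ 4       ≡⟨ [4a]⁴≡256a⁴ (suc q) ⟩
  256 ℕ.* suc q ℕ.^ 4       ≤⟨ ℕP.*-monoʳ-≤ 256 (ℕP.^-monoˡ-≤ 4 (suc≤2^ q)) ⟩
  256 ℕ.* (2 ℕ.^ q) ℕ.^ 4   ≡⟨ cong (256 ℕ.*_) (ℕP.^-*-assoc 2 q 4) ⟩
  256 ℕ.* 2 ℕ.^ (q ℕ.* 4)   ≤⟨ ℕP.*-monoʳ-≤ 256 (ℕP.^-monoʳ-≤ 2 4q≤n) ⟩
  256 ℕ.* 2 ℕ.^ n ∎
  where
  open ℕP.≤-Reasoning
  q : ℕ
  q = n ℕD./ 4
  division : n ≡ n ℕD.% 4 ℕ.+ q ℕ.* 4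
  division = ℕD.m≡m%n+[m/n]*n n 4
  n<4[q+1] : suc n ℕ.≤ suc q ℕ.* 4
  n<4[q+1] = subst (λ z → suc z ℕ.≤ suc q ℕ.* 4) (sym division)
                   (ℕP.+-monoˡ-≤ (q ℕ.* 4) (ℕD.m%n<n n 4))
  4q≤n : q ℕ.* 4 ℕ.≤ n
  4q≤n = subst (q ℕ.* 4 ℕ.≤_) (sym division) (ℕP.m≤n+m (q ℕ.* 4) (n ℕD.% 4))
  [4a]⁴≡256a⁴ : ∀ a → (a ℕ.* 4) ℕ.* ((a ℕ.* 4) ℕ.* ((a ℕ.* 4) ℕ.* ((a ℕ.* 4) ℕ.* 1)))
                      ≡ 256 ℕ.* (a ℕ.* (a ℕ.* (a ℕ.* (a ℕ.* 1))))
  [4a]⁴≡256a⁴ = ℕ-ring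

n^i*[n+1]≤256*2^n : ∀ n i → i ℕ.≤ 3 → n ℕ.^ i ℕ.* suc n ℕ.≤ 256 ℕ.* 2 ℕ.^ n
n^i*[n+1]≤256*2^n n i i≤3 = ℕP.≤-trans
  (ℕP.*-monoˡ-≤ (suc n) (ℕP.≤-trans (ℕP.^-monoˡ-≤ i (ℕP.n≤1+n n)) (ℕP.^-monoʳ-≤ (suc n) i≤3)))
  (ℕP.≤-trans (ℕP.≤-reflexive (ℕP.*-comm (suc n ℕ.^ 3) (suc n))) (pow4≤2^ n))

∣^∣ : ∀ a j → ∣ a ^ j ∣ ≡ ∣ a ∣ ^ j
∣^∣ a zero    = refl
∣^∣ a (suc j) = trans (∣p*q∣≡∣p∣*∣q∣ a (a ^ j)) (cong (∣ a ∣ *_) (∣^∣ a j))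

^-nonNeg : ∀ {a} j → 0ℚ ≤ a → 0ℚ ≤ a ^ j
^-nonNeg zero    0≤a = ≤ᵇ⇒≤ _
^-nonNeg {a} (suc j) 0≤a = nonNegative⁻¹ (a * a ^ j)
  {{nonNeg*nonNeg⇒nonNeg a {{nonNegative 0≤a}} (a ^ j) {{nonNegative (^-nonNeg j 0≤a)}}}}

^≤1 : ∀ {a} j → 0ℚ ≤ a → a ≤ 1ℚ → a ^ j ≤ 1ℚ
^≤1 zero    0≤a a≤1 = ≤-refl
^≤1 {a} (suc j) 0≤a a≤1 = begin
  a * a ^ j      ≤⟨ *-monoˡ-≤-nonNeg a {{nonNegative 0≤a}} (^≤1 j 0≤a a≤1) ⟩
  a * 1ℚ         ≡⟨ *-identityʳ a ⟩
  a              ≤⟨ a≤1 ⟩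
  1ℚ ∎
  where open ≤-Reasoning

½^*2^ : ∀ n → ½ ^ n * toℚ (2 ℕ.^ n) ≡ 1ℚ
½^*2^ zero    = refl
½^*2^ (suc n) = begin
  ½ * ½ ^ n * toℚ (2 ℕ.* 2 ℕ.^ n)       ≡⟨ cong (½ * ½ ^ n *_) (toℚ-* 2 (2 ℕ.^ n)) ⟩
  ½ * ½ ^ n * (toℚ 2 * toℚ (2 ℕ.^ n))   ≡⟨ solve 2 (λ h t → (con ½ :* h) :* (con (toℚ 2) :* t) := h :* t)
                                                  refl (½ ^ n) (toℚ (2 ℕ.^ n)) ⟩
  ½ ^ n * toℚ (2 ℕ.^ n)                 ≡⟨ ½^*2^ n ⟩
  1ℚ ∎
  where open ≡-Reasoning

∣decay^∣≤½^ : ∀ n k → ∣ decay n ^ suc k ∣ ≤ ½ ^ n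
∣decay^∣≤½^ n k = begin
  ∣ decay n ^ suc k ∣      ≡⟨ trans (∣^∣ (decay n) (suc k)) (cong (_^ suc k) (∣^∣ -½ n)) ⟩
  ½ ^ n * (½ ^ n) ^ k
    ≤⟨ *-monoˡ-≤-nonNeg (½ ^ n) {{nonNegative 0≤½^n}} (^≤1 k 0≤½^n (^≤1 n (≤ᵇ⇒≤ _) (≤ᵇ⇒≤ _))) ⟩
  ½ ^ n * 1ℚ               ≡⟨ *-identityʳ (½ ^ n) ⟩
  ½ ^ n ∎
  where
  open ≤-Reasoning
  0≤½^n : 0ℚ ≤ ½ ^ n
  0≤½^n = ^-nonNeg n (≤ᵇ⇒≤ _)

polynomial≤geometric : ∀ n i → i ℕ.≤ 3 → toℚ (n ℕ.^ i ℕ.* suc n) * ½ ^ n ≤ toℚ 256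
polynomial≤geometric n i i≤3 = begin
  toℚ (n ℕ.^ i ℕ.* suc n) * ½ ^ n
    ≤⟨ *-monoʳ-≤-nonNeg (½ ^ n) {{nonNegative (^-nonNeg n (≤ᵇ⇒≤ _))}}
         (toℚ-mono-≤ (n^i*[n+1]≤256*2^n n i i≤3)) ⟩
  toℚ (256 ℕ.* 2 ℕ.^ n) * ½ ^ n
    ≡⟨ cong (_* ½ ^ n) (toℚ-* 256 (2 ℕ.^ n)) ⟩
  toℚ 256 * toℚ (2 ℕ.^ n) * ½ ^ n
    ≡⟨ solve 3 (λ k p h → k :* p :* h := k :* (h :* p)) refl (toℚ 256) (toℚ (2 ℕ.^ n)) (½ ^ n) ⟩
  toℚ 256 * (½ ^ n * toℚ (2 ℕ.^ n))
    ≡⟨ cong (toℚ 256 *_) (½^*2^ n) ⟩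
  toℚ 256 * 1ℚ
    ≡⟨ *-identityʳ (toℚ 256) ⟩
  toℚ 256 ∎
  where open ≤-Reasoning

Small : ℚ × ℕ × ℕ → Set
Small (c , i , k) = i ℕ.≤ 3 × ∣ c ∣ ≤ 1ℚ

term-bound : ∀ c i k → Small (c , i , k) →
  InverseBound (λ n → c * (toℚ n ^ i * decay n ^ suc k)) 256
term-bound c i k (i≤3 , ∣c∣≤1) n = begin
  ∣ c * (x ^ i * r ^ suc k) ∣ * t
    ≡⟨ cong (_* t) (∣p*q∣≡∣p∣*∣q∣ c _) ⟩
  ∣ c ∣ * ∣ x ^ i * r ^ suc k ∣ * t
    ≤⟨ *-monoʳ-≤-nonNeg t {{nonNegative (toℚ-nonNeg (suc n))}}
         (*-monoʳ-≤-nonNeg ∣ x ^ i * r ^ suc k ∣ {{nonNegative (0≤∣p∣ (x ^ i * r ^ suc k))}} ∣c∣≤1) ⟩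
  1ℚ * ∣ x ^ i * r ^ suc k ∣ * t
    ≡⟨ cong (_* t) (trans (*-identityˡ _) (trans (∣p*q∣≡∣p∣*∣q∣ (x ^ i) _)
                                                  (cong (_* ∣ r ^ suc k ∣) ∣x^i∣))) ⟩
  toℚ (n ℕ.^ i) * ∣ r ^ suc k ∣ * t
    ≤⟨ *-monoʳ-≤-nonNeg t {{nonNegative (toℚ-nonNeg (suc n))}}
         (*-monoˡ-≤-nonNeg (toℚ (n ℕ.^ i)) {{nonNegative (toℚ-nonNeg (n ℕ.^ i))}} (∣decay^∣≤½^ n k)) ⟩
  toℚ (n ℕ.^ i) * ½ ^ n * t
    ≡⟨ solve 3 (λ a h t → a :* h :* t := a :* t :* h) refl (toℚ (n ℕ.^ i)) (½ ^ n) t ⟩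
  toℚ (n ℕ.^ i) * t * ½ ^ n
    ≡⟨ cong (_* ½ ^ n) (toℚ-* (n ℕ.^ i) (suc n)) ⟨
  toℚ (n ℕ.^ i ℕ.* suc n) * ½ ^ n
    ≤⟨ polynomial≤geometric n i i≤3 ⟩
  toℚ 256 ∎
  where
  open ≤-Reasoning
  x r t : ℚ
  x = toℚ n
  r = decay n
  t = toℚ (suc n)
  ∣x^i∣ : ∣ x ^ i ∣ ≡ toℚ (n ℕ.^ i)
  ∣x^i∣ = trans (cong ∣_∣ (sym (toℚ-^ n i))) (0≤p⇒∣p∣≡p (toℚ-nonNeg (n ℕ.^ i)))

decaying-bound : ∀ L → All Small L →
  InverseBound (λ n → V.decaying L (toℚ n) (decay n)) (256 ℕ.* length L)
decaying-bound [] [] n = ≤-reflexive (*-zeroˡ (toℚ (suc n)))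
decaying-bound ((c , i , k) ∷ L) (small ∷ smalls) =
  subst (InverseBound (λ n → V.decaying ((c , i , k) ∷ L) (toℚ n) (decay n)))
        (sym (ℕP.*-suc 256 (length L)))
        (inverseBound-+ (λ n → c * (toℚ n ^ i * decay n ^ suc k))
                        (λ n → V.decaying L (toℚ n) (decay n)) 256 (256 ℕ.* length L)
                        (term-bound c i k small) (decaying-bound L smalls))

small? : ∀ t → Dec (Small t)
small? (c , i , k) = (i ℕ.≤? 3) ×-dec (∣ c ∣ ≤? 1ℚ)

smallTerms : (j : Fin 5) → All Small (errorTerms j)
smallTerms 0F = toWitness {a? = all? small? (errorTerms 0F)} _
smallTerms 1F = toWitness {a? = all? small? (errorTerms 1F)} _
smallTerms 2F = toWitness {a? = all? small? (errorTerms 2F)} _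
smallTerms 3F = toWitness {a? = all? small? (errorTerms 3F)} _
smallTerms 4F = toWitness {a? = all? small? (errorTerms 4F)} _

statistic-littleO : (j : Fin 5) →
  IsLittleO1 (λ n → statistic (toℕ j) n - V.approximation j (toℚ n))
statistic-littleO j = littleO-cong error-closed
  (inverseBound⇒littleO (λ n → V.decaying (errorTerms j) (toℚ n) (decay n))
                        (256 ℕ.* length (errorTerms j))
                        (decaying-bound (errorTerms j) (smallTerms j)))
  where
  error-closed : ∀ n → statistic (toℕ j) n - V.approximation j (toℚ n)
                       ≡ V.decaying (errorTerms j) (toℚ n) (decay n)
  error-closed n =
    trans (cong (_- V.approximation j (toℚ n)) (statistic-closed (toℕ j) n (toℕ≤pred[n] j)))
          (error-identity j (toℚ n) (decay n))

proposition1 :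
    IsLittleO1 (λ n → mean n - ((+ 2 / 3) * toℚ n + + 2 / 9))
    × IsLittleO1 (λ n → centralMoment 2 n - ((+ 2 / 27) * toℚ n + + 2 / 81))
    × IsLittleO1 (λ n → centralMoment 3 n - ((+ 2 / 81) * toℚ n - + 26 / 729))
    × IsLittleO1 (λ n → centralMoment 4 n
        - ((+ 4 / 243) * (toℚ n * toℚ n) + (+ 2 / 243) * toℚ n - + 62 / 2187))
proposition1 =
  statistic-littleO 1F , statistic-littleO 2F , statistic-littleO 3F , statistic-littleO 4F
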